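{- For all integers $n\ge 5$, $$\sum_{j=0}^{\lfloor n/2\rfloor}\chi^{(n-j,j)}\big(3\,2\,1^{n-5}\big)^2=\frac{n^4-20n^3+194n^2-1045n+2520}{4(2n-1)(2n-3)(2n-5)(2n-7)(n+1)}\binom{2n}{n}.$$
   Context: For partitions $\lambda,\mu$ of $n$, $\chi^{\lambda}(\mu)$ is the value of the irreducible character of $S_n$ indexed by $\lambda$ on permutations of cycle type $\mu$. $(n-j,j)$ is the shape with rows $n-j$ and $j$ (one row when $j=0$); $3\,2\,1^{n-5}$ is the partition of $n$ with parts $3$, $2$ and $n-5$ parts $1$. -}

module Defs where

open import Data.Bool using (Bool; true; false; if_then_else_; _∧_; not)
open import Data.Nat using (ℕ; zero; suc; _+_; _∸_; _≡ᵇ_; _<ᵇ_; _≤ᵇ_)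
open import Data.Integer as ℤ using (ℤ; 0ℤ; 1ℤ; -_)
open import Data.List using (List; []; _∷_; map; length; filterᵇ; replicate)
open import Data.Bool.ListAction using (any)

-- Partitions and cycle types are lists of positive naturals
-- (partitions written in weakly decreasing order).

sgn : ℕ → ℤ
sgn zero          = 1ℤ
sgn (suc zero)    = - 1ℤ
sgn (suc (suc m)) = sgn m

sumℤ : List ℤ → ℤ
sumℤ []       = 0ℤ
sumℤ (x ∷ xs) = x ℤ.+ sumℤ xs

-- β-set (first-column hook lengths) of a partition λ₁ ≥ … ≥ λ_ℓ :
-- β_i = λ_i + (ℓ - i).
betaSet : List ℕ → List ℕ
betaSet []       = []
betaSet (x ∷ xs) = (x + length xs) ∷ betaSet xs

memᵇ : ℕ → List ℕ → Bool
memᵇ x = any (λ c → c ≡ᵇ x)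

-- Murnaghan–Nakayama rule on β-sets: removing a rim k-hook from λ
-- corresponds to replacing some b ∈ β by b - k (with b - k ∉ β);
-- its height (leg length) is the number of c ∈ β with b - k < c < b.
mn : List ℕ → List ℕ → ℤ
mn β []      = 1ℤ
mn β (k ∷ μ) = sumℤ (map term β)
  where
  term : ℕ → ℤ
  term b =
    if (k ≤ᵇ b) ∧ not (memᵇ (b ∸ k) β)
    then sgn (length (filterᵇ (λ c → ((b ∸ k) <ᵇ c) ∧ (c <ᵇ b)) β))
           ℤ.* mn (map (λ c → if c ≡ᵇ b then b ∸ k else c) β) μ
    else 0ℤ

-- χ λ μ : value of the irreducible character of S_n indexed by λ
-- on permutations of cycle type μ (|λ| = |μ| = n), via Murnaghan–Nakayama.
χ : List ℕ → List ℕ → ℤ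
χ la μ = mn (betaSet la) μ

twoRow : ℕ → ℕ → List ℕ
twoRow n zero    = n ∷ []
twoRow n (suc j) = (n ∸ suc j) ∷ suc j ∷ []

type321 : ℕ → List ℕ
type321 n = 3 ∷ 2 ∷ replicate (n ∸ 5) 1

sumTo : ℕ → (ℕ → ℤ) → ℤ
sumTo zero    f = f 0
sumTo (suc m) f = sumTo m f ℤ.+ f (suc m)

{-# OPTIONS --safe #-}
module Submission where

-- By the Murnaghan–Nakayama rule on the β-set {n − j + 1, j}, the character value
-- χ^(n−j,j)(μ) is the coefficient u_j of x^j in (1 − x) ∏ (1 + x^μᵢ).  Swapping the two
-- beads shows u_(n+1−j) = −u_j, so twice the sum of the squares over j ≤ n/2 equals
-- Σ_(j ≤ n+1) u_j² = −Σ_j u_j u_(n+1−j), i.e. minus the coefficient of x^(n+1) in the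
-- square of the generating polynomial.  For μ = 3 2 1^m that square is
-- ((1 − x)(1 + x³)(1 + x²))² (1 + x)^(2m), so the sum is an explicit combination of the
-- binomials C(2m, m ± e), e ≤ 6.  Writing them, and C(2n, n) with n = m + 5, as
-- C(2m, m) times ratios of consecutive binomials leaves a polynomial identity in m.

module Binomial where
  open import Data.Nat.Base
  open import Data.Nat.Properties
  open import Data.Nat.Combinatorics using (_C_; nCk+nC[k+1]≡[n+1]C[k+1]; k>n⇒nCk≡0; nCk≡nC[n∸k]; nC1≡n)
  open import Data.Nat.Tactic.RingSolver using (solve-∀)
  open import Data.Sum.Base using (inj₁; inj₂)
  open import Relation.Binary.PropositionalEquality
  open import Relation.Nullary.Decidable using (yes; no)

  pascal : ∀ n k → suc n C suc k ≡ n C k + n C suc k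
  pascal n k = sym (nCk+nC[k+1]≡[n+1]C[k+1] n k)

  absorption : ∀ n k → (n C suc k) * suc k ≡ (n C k) * (n ∸ k)
  absorption zero    k       = sym (trans (cong ((0 C k) *_) (0∸n≡0 k)) (*-zeroʳ (0 C k)))
  absorption (suc n) zero    = trans (*-identityʳ (suc n C 1)) (trans (nC1≡n (suc n)) (sym (+-identityʳ (suc n))))
  absorption (suc n) (suc k) = begin
    (suc n C suc (suc k)) * suc (suc k)
      ≡⟨ cong (_* suc (suc k)) (pascal n (suc k)) ⟩
    (n C suc k + n C suc (suc k)) * suc (suc k)
      ≡⟨ regroup (n C suc k) (n C suc (suc k)) k ⟩
    (n C suc k) * suc k + (n C suc k + (n C suc (suc k)) * suc (suc k))
      ≡⟨ cong₂ (λ x y → x + (n C suc k + y)) (absorption n k) (absorption n (suc k)) ⟩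
    (n C k) * (n ∸ k) + (n C suc k + (n C suc k) * (n ∸ suc k))
      ≡⟨ cong ((n C k) * (n ∸ k) +_) absorb-one ⟩
    (n C k) * (n ∸ k) + (n C suc k) * (n ∸ k)
      ≡⟨ *-distribʳ-+ (n ∸ k) (n C k) (n C suc k) ⟨
    (n C k + n C suc k) * (n ∸ k)
      ≡⟨ cong (_* (n ∸ k)) (pascal n k) ⟨
    (suc n C suc k) * (suc n ∸ suc k)
      ∎
    where
    open ≡-Reasoning
    regroup : ∀ a b k → (a + b) * suc (suc k) ≡ a * suc k + (a + b * suc (suc k))
    regroup = solve-∀
    absorb-one : n C suc k + (n C suc k) * (n ∸ suc k) ≡ (n C suc k) * (n ∸ k)
    absorb-one with suc k ≤? n
    ... | yes k<n = trans (sym (*-suc (n C suc k) (n ∸ suc k))) (cong ((n C suc k) *_) (sym (+-∸-assoc 1 k<n)))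
    ... | no  k≮n rewrite k>n⇒nCk≡0 (≰⇒> k≮n) = refl

  upper-absorption : ∀ n k → (suc n C suc k) * suc k ≡ (n C k) * suc n
  upper-absorption n k = begin
    (suc n C suc k) * suc k                   ≡⟨ cong (_* suc k) (pascal n k) ⟩
    (n C k + n C suc k) * suc k               ≡⟨ *-distribʳ-+ (suc k) (n C k) (n C suc k) ⟩
    (n C k) * suc k + (n C suc k) * suc k     ≡⟨ cong ((n C k) * suc k +_) (absorption n k) ⟩
    (n C k) * suc k + (n C k) * (n ∸ k)       ≡⟨ *-distribˡ-+ (n C k) (suc k) (n ∸ k) ⟨
    (n C k) * (suc k + (n ∸ k))               ≡⟨ total ⟩
    (n C k) * suc n                           ∎
    where
    open ≡-Reasoning
    total : (n C k) * (suc k + (n ∸ k)) ≡ (n C k) * suc n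
    total with k ≤? n
    ... | yes k≤n = cong (λ x → (n C k) * suc x) (m+[n∸m]≡n k≤n)
    ... | no  k≰n rewrite k>n⇒nCk≡0 (≰⇒> k≰n) = refl

  central-binomial-step : ∀ a → ((2 * suc a) C suc a) * suc a ≡ ((2 * a) C a) * (2 * suc (2 * a))
  central-binomial-step a = begin
    ((2 * suc a) C suc a) * suc a               ≡⟨ cong (λ x → (x C suc a) * suc a) (*-suc 2 a) ⟩
    (suc (suc N) C suc a) * suc a               ≡⟨ cong (_* suc a) (pascal (suc N) a) ⟩
    (suc N C a + suc N C suc a) * suc a         ≡⟨ cong (λ x → (x + suc N C suc a) * suc a) reflect ⟩
    (suc N C suc a + suc N C suc a) * suc a     ≡⟨ double (suc N C suc a) (suc a) ⟩
    2 * ((suc N C suc a) * suc a)               ≡⟨ cong (2 *_) (upper-absorption N a) ⟩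
    2 * ((N C a) * suc N)                       ≡⟨ double′ (N C a) (suc N) ⟩
    (N C a) * (2 * suc N)                       ∎
    where
    open ≡-Reasoning
    N = 2 * a
    reflect : suc N C a ≡ suc N C suc a
    reflect = trans (nCk≡nC[n∸k] (m≤n⇒m≤1+n (m≤m+n a (a + 0))))
                    (cong (suc N C_) (trans (cong (λ x → suc (a + x) ∸ a) (+-identityʳ a)) (m+n∸n≡m (suc a) a)))
    double : ∀ x y → (x + x) * y ≡ 2 * (x * y)
    double = solve-∀
    double′ : ∀ x y → 2 * (x * y) ≡ x * (2 * y)
    double′ = solve-∀

  central-symmetry : ∀ m j → (2 * m) C j ≡ (2 * m) C (∣ j - m ∣ + m)
  central-symmetry m j with ≤-total m j
  ... | inj₁ m≤j = cong ((2 * m) C_) (sym (trans (cong (_+ m) (m≤n⇒∣n-m∣≡n∸m m≤j)) (m∸n+n≡m m≤j)))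
  ... | inj₂ j≤m = trans (nCk≡nC[n∸k] (≤-trans j≤m (m≤m+n m (m + 0))))
                         (cong ((2 * m) C_) (sym (trans (cong (_+ m) (m≤n⇒∣m-n∣≡n∸m j≤m)) mirror)))
    where
    mirror : (m ∸ j) + m ≡ 2 * m ∸ j
    mirror = trans (sym (+-∸-comm m j≤m)) (cong (λ x → (m + x) ∸ j) (sym (+-identityʳ m)))

open Binomial

open import Defs
open import Data.Bool.Base using (true; false; if_then_else_; _∧_; not)
open import Data.Empty using (⊥-elim)
open import Data.Integer using (ℤ; +_; _+_; _-_; _*_; _^_)
open import Data.Integer.Base using (-[1+_]; 0ℤ; 1ℤ; -1ℤ; -_; NonZero)
open import Data.Integer.Properties
  using (+-identityˡ; +-identityʳ; +-assoc; +-comm; *-zeroʳ; *-identityˡ; *-identityʳ; *-comm; *-assoc;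
         pos-+; pos-*; neg-distrib-+; neg-distribʳ-*; *-cancelˡ-≡; i*j≢0; m-n≡m⊖n; ⊖-≥)
open import Data.Integer.Tactic.RingSolver using (solve-∀)
open import Data.List.Base using (List; []; _∷_; map; replicate; length; filterᵇ)
open import Data.List.Relation.Unary.All using (All; []; _∷_)
import Data.List.Relation.Unary.All.Properties as All
open import Data.Nat as ℕ using (ℕ; _≤_; _/_)
open import Data.Nat.Base using (zero; suc; _∸_; z≤n; s≤s; ∣_-_∣)
import Data.Nat.Properties as ℕ
open import Data.Nat.Combinatorics using (_C_)
open import Data.Nat.DivMod using (m/n≡1+[m∸n]/n)
open import Data.Nat.ListAction using (sum)
open import Data.Sum.Base using (_⊎_; inj₁; inj₂)
open import Function.Base using (_∘_)
open import Relation.Binary.Definitions using (tri<; tri≈; tri>)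
open import Relation.Binary.PropositionalEquality
open import Relation.Nullary.Decidable using (yes; no; dec-true; dec-false)
open import Relation.Nullary.Negation using (¬_)
open import Relation.Nullary.Reflects using (ofʸ; ofⁿ)

-- Finite sums

sumTo-cong : ∀ n {f g : ℕ → ℤ} → (∀ j → j ℕ.≤ n → f j ≡ g j) → sumTo n f ≡ sumTo n g
sumTo-cong zero    f≡g = f≡g 0 z≤n
sumTo-cong (suc n) f≡g =
  cong₂ _+_ (sumTo-cong n (λ j j≤n → f≡g j (ℕ.m≤n⇒m≤1+n j≤n))) (f≡g (suc n) ℕ.≤-refl)

sumTo-zero : ∀ n → sumTo n (λ _ → 0ℤ) ≡ 0ℤ
sumTo-zero zero    = refl
sumTo-zero (suc n) = cong (_+ 0ℤ) (sumTo-zero n)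

sumTo-linear : ∀ n a (f g : ℕ → ℤ) → sumTo n (λ j → a * f j + g j) ≡ a * sumTo n f + sumTo n g
sumTo-linear zero    a f g = refl
sumTo-linear (suc n) a f g =
  trans (cong (_+ (a * f (suc n) + g (suc n))) (sumTo-linear n a f g))
        (regroup a (sumTo n f) (sumTo n g) (f (suc n)) (g (suc n)))
  where
  regroup : ∀ a x y u v → (a * x + y) + (a * u + v) ≡ a * (x + u) + (y + v)
  regroup = solve-∀

sumTo-neg : ∀ n (f : ℕ → ℤ) → sumTo n (λ j → - f j) ≡ - sumTo n f
sumTo-neg zero    f = refl
sumTo-neg (suc n) f = trans (cong (_+ - f (suc n)) (sumTo-neg n f)) (sym (neg-distrib-+ (sumTo n f) (f (suc n))))

sumTo-head : ∀ n (f : ℕ → ℤ) → sumTo (suc n) f ≡ f 0 + sumTo n (λ j → f (suc j))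
sumTo-head zero    f = refl
sumTo-head (suc n) f = trans (cong (_+ f (suc (suc n))) (sumTo-head n f)) (+-assoc (f 0) _ _)

sumTo-reverse : ∀ n (f : ℕ → ℤ) → sumTo n f ≡ sumTo n (λ j → f (n ∸ j))
sumTo-reverse zero    f = refl
sumTo-reverse (suc n) f = begin
  sumTo (suc n) f                                    ≡⟨ sumTo-head n f ⟩
  f 0 + sumTo n (λ j → f (suc j))                    ≡⟨ cong (λ s → f 0 + s) (sumTo-reverse n _) ⟩
  f 0 + sumTo n (λ j → f (suc (n ∸ j)))              ≡⟨ +-comm (f 0) _ ⟩
  sumTo n (λ j → f (suc (n ∸ j))) + f 0
    ≡⟨ cong₂ _+_ (sumTo-cong n reindex) (cong f (sym (ℕ.n∸n≡0 n))) ⟩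
  sumTo n (λ j → f (suc n ∸ j)) + f (suc n ∸ suc n)  ∎
  where
  open ≡-Reasoning
  reindex : ∀ j → j ℕ.≤ n → f (suc (n ∸ j)) ≡ f (suc n ∸ j)
  reindex j j≤n = cong f (sym (ℕ.+-∸-assoc 1 j≤n))

sumTo-split : ∀ a b (f : ℕ → ℤ) → sumTo (suc (b ℕ.+ a)) f ≡ sumTo a f + sumTo b (λ i → f (suc (i ℕ.+ a)))
sumTo-split a zero    f = refl
sumTo-split a (suc b) f =
  trans (cong (_+ f (suc (suc (b ℕ.+ a)))) (sumTo-split a b f)) (+-assoc (sumTo a f) _ _)

-- Power series and the action of coefficient lists

Seq : Set
Seq = ℕ → ℤ

shift : Seq → Seq
shift f zero    = 0ℤ
shift f (suc j) = f j

shift-cong : ∀ {f g} → f ≗ g → shift f ≗ shift g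
shift-cong f≗g zero    = refl
shift-cong f≗g (suc j) = f≗g j

shift-zero : shift (λ _ → 0ℤ) ≗ λ _ → 0ℤ
shift-zero zero    = refl
shift-zero (suc j) = refl

shift-scale : ∀ a f → shift (λ j → a * f j) ≗ λ j → a * shift f j
shift-scale a f zero    = sym (*-zeroʳ a)
shift-scale a f (suc j) = refl

shift-+ : ∀ f g → shift (λ j → f j + g j) ≗ λ j → shift f j + shift g j
shift-+ f g zero    = refl
shift-+ f g (suc j) = refl

Poly : Set
Poly = List ℤ

infix 8 _⋆_

-- A coefficient list (constant term first) acts on a sequence as multiplication of
-- generating functions: (P ⋆ f) j = Σᵢ Pᵢ f (j − i).
_⋆_ : Poly → Seq → Seq
([]      ⋆ f) j = 0ℤ
((p ∷ P) ⋆ f) j = p * f j + shift (P ⋆ f) j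

⋆-cong : ∀ P {f g} → f ≗ g → P ⋆ f ≗ P ⋆ g
⋆-cong []      f≗g j = refl
⋆-cong (p ∷ P) f≗g j = cong₂ _+_ (cong (p *_) (f≗g j)) (shift-cong (⋆-cong P f≗g) j)

⋆-cong-≤ : ∀ P {f g : Seq} j → (∀ i → i ℕ.≤ j → f i ≡ g i) → (P ⋆ f) j ≡ (P ⋆ g) j
⋆-cong-≤ []      j       f≡g = refl
⋆-cong-≤ (p ∷ P) zero    f≡g = cong (λ x → p * x + 0ℤ) (f≡g 0 z≤n)
⋆-cong-≤ (p ∷ P) (suc j) f≡g =
  cong₂ (λ x y → p * x + y) (f≡g (suc j) ℕ.≤-refl)
                            (⋆-cong-≤ P j (λ i i≤j → f≡g i (ℕ.m≤n⇒m≤1+n i≤j)))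

⋆-linear : ∀ P a f g → P ⋆ (λ j → a * f j + g j) ≗ λ j → a * (P ⋆ f) j + (P ⋆ g) j
⋆-linear []      a f g j = sym (trans (+-identityʳ _) (*-zeroʳ a))
⋆-linear (p ∷ P) a f g j = begin
  p * (a * f j + g j) + shift (P ⋆ (λ i → a * f i + g i)) j
    ≡⟨ cong (_+_ (p * (a * f j + g j))) (trans (shift-cong (⋆-linear P a f g) j)
                                               (trans (shift-+ _ _ j) (cong (_+ _) (shift-scale a _ j)))) ⟩
  p * (a * f j + g j) + (a * shift (P ⋆ f) j + shift (P ⋆ g) j)
    ≡⟨ regroup p a (f j) (g j) _ _ ⟩
  a * (p * f j + shift (P ⋆ f) j) + (p * g j + shift (P ⋆ g) j)
    ∎
  where
  open ≡-Reasoning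
  regroup : ∀ p a x y u v → p * (a * x + y) + (a * u + v) ≡ a * (p * x + u) + (p * y + v)
  regroup = solve-∀

⋆-shift : ∀ P f → P ⋆ shift f ≗ shift (P ⋆ f)
⋆-shift []      f j       = sym (shift-zero j)
⋆-shift (p ∷ P) f zero    = trans (+-identityʳ _) (*-zeroʳ p)
⋆-shift (p ∷ P) f (suc j) = cong (_+_ (p * f j)) (⋆-shift P f j)

record LinearShiftInvariant (T : Seq → Seq) : Set where
  field
    respects : ∀ {f g} → f ≗ g → T f ≗ T g
    linear   : ∀ a f g → T (λ j → a * f j + g j) ≗ λ j → a * T f j + T g j
    commutes : ∀ f → T (shift f) ≗ shift (T f)

  zero-preserving : T (λ _ → 0ℤ) ≗ λ _ → 0ℤ
  zero-preserving j = begin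
    T (λ _ → 0ℤ) j                           ≡⟨ respects {g = λ _ → -1ℤ * 0ℤ + 0ℤ} (λ _ → refl) j ⟩
    T (λ _ → -1ℤ * 0ℤ + 0ℤ) j                ≡⟨ linear -1ℤ (λ _ → 0ℤ) (λ _ → 0ℤ) j ⟩
    -1ℤ * T (λ _ → 0ℤ) j + T (λ _ → 0ℤ) j    ≡⟨ cancel (T (λ _ → 0ℤ) j) ⟩
    0ℤ                                       ∎
    where
    open ≡-Reasoning
    cancel : ∀ x → -1ℤ * x + x ≡ 0ℤ
    cancel = solve-∀

⋆-commute : ∀ {T} → LinearShiftInvariant T → ∀ P f → T (P ⋆ f) ≗ P ⋆ T f
⋆-commute lsi []      f j = zero-preserving j
  where open LinearShiftInvariant lsi
⋆-commute lsi (p ∷ P) f j =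
  trans (linear p f (shift (P ⋆ f)) j)
        (cong (_+_ (p * _)) (trans (commutes (P ⋆ f) j) (shift-cong (⋆-commute lsi P f) j)))
  where open LinearShiftInvariant lsi

⋆-linearShiftInvariant : ∀ P → LinearShiftInvariant (P ⋆_)
⋆-linearShiftInvariant P = record
  { respects = ⋆-cong P
  ; linear   = ⋆-linear P
  ; commutes = ⋆-shift P
  }

scale-linearShiftInvariant : ∀ a → LinearShiftInvariant (λ f j → a * f j)
scale-linearShiftInvariant a = record
  { respects = λ f≗g j → cong (a *_) (f≗g j)
  ; linear   = λ b f g j → distrib a b (f j) (g j)
  ; commutes = λ f j → sym (shift-scale a f j)
  }
  where
  distrib : ∀ a b x y → a * (b * x + y) ≡ b * (a * x) + a * y
  distrib = solve-∀

infixl 6 _+ₚ_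
infixl 7 _·ₚ_

_+ₚ_ : Poly → Poly → Poly
[]      +ₚ Q       = Q
(p ∷ P) +ₚ []      = p ∷ P
(p ∷ P) +ₚ (q ∷ Q) = p + q ∷ P +ₚ Q

_·ₚ_ : Poly → Poly → Poly
[]      ·ₚ Q = []
(p ∷ P) ·ₚ Q = map (p *_) Q +ₚ (0ℤ ∷ P ·ₚ Q)

⋆-+ₚ : ∀ P Q f → (P +ₚ Q) ⋆ f ≗ λ j → (P ⋆ f) j + (Q ⋆ f) j
⋆-+ₚ []      Q       f j = sym (+-identityˡ _)
⋆-+ₚ (p ∷ P) []      f j = sym (+-identityʳ _)
⋆-+ₚ (p ∷ P) (q ∷ Q) f j =
  trans (cong (_+_ ((p + q) * f j)) (trans (shift-cong (⋆-+ₚ P Q f) j) (shift-+ _ _ j)))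
        (regroup p q (f j) _ _)
  where
  regroup : ∀ p q x u v → (p + q) * x + (u + v) ≡ (p * x + u) + (q * x + v)
  regroup = solve-∀

⋆-scale : ∀ a P f → map (a *_) P ⋆ f ≗ λ j → a * (P ⋆ f) j
⋆-scale a []      f j = sym (*-zeroʳ a)
⋆-scale a (p ∷ P) f j =
  trans (cong (_+_ (a * p * f j)) (trans (shift-cong (⋆-scale a P f) j) (shift-scale a _ j)))
        (regroup a p (f j) _)
  where
  regroup : ∀ a p x u → a * p * x + a * u ≡ a * (p * x + u)
  regroup = solve-∀

⋆-·ₚ : ∀ P Q f → (P ·ₚ Q) ⋆ f ≗ P ⋆ (Q ⋆ f)
⋆-·ₚ []      Q f j = refl
⋆-·ₚ (p ∷ P) Q f j = begin
  ((map (p *_) Q +ₚ (0ℤ ∷ P ·ₚ Q)) ⋆ f) j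
    ≡⟨ ⋆-+ₚ (map (p *_) Q) (0ℤ ∷ P ·ₚ Q) f j ⟩
  (map (p *_) Q ⋆ f) j + (0ℤ * f j + shift ((P ·ₚ Q) ⋆ f) j)
    ≡⟨ cong₂ _+_ (⋆-scale p Q f j) (trans (+-identityˡ _) (shift-cong (⋆-·ₚ P Q f) j)) ⟩
  p * (Q ⋆ f) j + shift (P ⋆ (Q ⋆ f)) j
    ∎
  where open ≡-Reasoning

cauchy : Seq → Seq → Seq
cauchy f g n = sumTo n (λ j → f j * g (n ∸ j))

cauchy-cong : ∀ {f f′ g g′} → f ≗ f′ → g ≗ g′ → cauchy f g ≗ cauchy f′ g′
cauchy-cong f≗f′ g≗g′ n = sumTo-cong n (λ j _ → cong₂ _*_ (f≗f′ j) (g≗g′ (n ∸ j)))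

cauchy-comm : ∀ f g → cauchy f g ≗ cauchy g f
cauchy-comm f g n = trans (sumTo-reverse n _) (sumTo-cong n reflect)
  where
  reflect : ∀ j → j ℕ.≤ n → f (n ∸ j) * g (n ∸ (n ∸ j)) ≡ g j * f (n ∸ j)
  reflect j j≤n = trans (cong (λ i → f (n ∸ j) * g i) (ℕ.m∸[m∸n]≡n j≤n)) (*-comm (f (n ∸ j)) (g j))

cauchy-linearShiftInvariantˡ : ∀ g → LinearShiftInvariant (λ f → cauchy f g)
cauchy-linearShiftInvariantˡ g = record
  { respects = λ f≗f′ → cauchy-cong {g = g} f≗f′ (λ _ → refl)
  ; linear   = λ a f h n → trans (sumTo-cong n (λ j _ → distrib a (f j) (h j) (g (n ∸ j))))
                                 (sumTo-linear n a _ _)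
  ; commutes = commutes
  }
  where
  distrib : ∀ a x y z → (a * x + y) * z ≡ a * (x * z) + y * z
  distrib = solve-∀
  commutes : ∀ f → cauchy (shift f) g ≗ shift (cauchy f g)
  commutes f zero    = refl
  commutes f (suc n) = trans (sumTo-head n _) (+-identityˡ _)

cauchy-⋆ˡ : ∀ P f g → cauchy (P ⋆ f) g ≗ P ⋆ cauchy f g
cauchy-⋆ˡ P f g = ⋆-commute (cauchy-linearShiftInvariantˡ g) P f

cauchy-⋆ : ∀ P Q f g → cauchy (P ⋆ f) (Q ⋆ g) ≗ (P ·ₚ Q) ⋆ cauchy f g
cauchy-⋆ P Q f g n = begin
  cauchy (P ⋆ f) (Q ⋆ g) n      ≡⟨ cauchy-⋆ˡ P f (Q ⋆ g) n ⟩
  (P ⋆ cauchy f (Q ⋆ g)) n      ≡⟨ ⋆-cong P ⋆ʳ n ⟩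
  (P ⋆ (Q ⋆ cauchy f g)) n      ≡⟨ ⋆-·ₚ P Q (cauchy f g) n ⟨
  ((P ·ₚ Q) ⋆ cauchy f g) n     ∎
  where
  open ≡-Reasoning
  ⋆ʳ : cauchy f (Q ⋆ g) ≗ Q ⋆ cauchy f g
  ⋆ʳ i = trans (cauchy-comm f (Q ⋆ g) i) (trans (cauchy-⋆ˡ Q g f i) (⋆-cong Q (cauchy-comm g f) i))

binom : ℕ → Seq
binom m j = + (m C j)

binom-suc : ∀ m → binom (suc m) ≗ (1ℤ ∷ 1ℤ ∷ []) ⋆ binom m
binom-suc m zero    = refl
binom-suc m (suc j) = begin
  + (suc m C suc j)                               ≡⟨ cong +_ (pascal m j) ⟩
  + (m C j ℕ.+ m C suc j)                         ≡⟨ pos-+ (m C j) (m C suc j) ⟩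
  binom m j + binom m (suc j)                     ≡⟨ regroup (binom m j) (binom m (suc j)) ⟩
  1ℤ * binom m (suc j) + (1ℤ * binom m j + 0ℤ)
    ≡⟨ cong (λ z → 1ℤ * binom m (suc j) + (1ℤ * binom m j + z)) (shift-zero j) ⟨
  ((1ℤ ∷ 1ℤ ∷ []) ⋆ binom m) (suc j)              ∎
  where
  open ≡-Reasoning
  regroup : ∀ x y → x + y ≡ 1ℤ * y + (1ℤ * x + 0ℤ)
  regroup = solve-∀

vandermonde : ∀ a b → cauchy (binom a) (binom b) ≗ binom (a ℕ.+ b)
vandermonde zero    b zero    = *-identityˡ _
vandermonde zero    b (suc n) =
  trans (sumTo-head n _) (trans (cong (_+_ (1ℤ * binom b (suc n))) (sumTo-zero n))
                                (trans (+-identityʳ _) (*-identityˡ _)))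
vandermonde (suc a) b n = begin
  cauchy (binom (suc a)) (binom b) n       ≡⟨ cauchy-cong {g = binom b} (binom-suc a) (λ _ → refl) n ⟩
  cauchy (1+X ⋆ binom a) (binom b) n       ≡⟨ cauchy-⋆ˡ 1+X (binom a) (binom b) n ⟩
  (1+X ⋆ cauchy (binom a) (binom b)) n     ≡⟨ ⋆-cong 1+X (vandermonde a b) n ⟩
  (1+X ⋆ binom (a ℕ.+ b)) n                ≡⟨ binom-suc (a ℕ.+ b) n ⟨
  binom (suc a ℕ.+ b) n                    ∎
  where
  open ≡-Reasoning
  1+X = 1ℤ ∷ 1ℤ ∷ []

-- Subset sums and Murnaghan–Nakayama on two beads

X^_ : ℕ → Poly
X^ zero    = 1ℤ ∷ []
X^ (suc k) = 0ℤ ∷ X^ k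

1+X^_ : ℕ → Poly
1+X^ k = (1ℤ ∷ []) +ₚ X^ k

1-X : Poly
1-X = 1ℤ ∷ -1ℤ ∷ []

X^-⋆ : ∀ k f j → (X^ k ⋆ f) j ≡ (if k ℕ.≤ᵇ j then f (j ∸ k) else 0ℤ)
X^-⋆ zero          f j       = trans (cong (_+_ (1ℤ * f j)) (shift-zero j)) (trans (+-identityʳ _) (*-identityˡ _))
X^-⋆ (suc k)       f zero    = refl
X^-⋆ (suc zero)    f (suc j) = trans (+-identityˡ _) (X^-⋆ zero f j)
X^-⋆ (suc (suc k)) f (suc j) = trans (+-identityˡ _) (X^-⋆ (suc k) f j)

1+X^-⋆ : ∀ k f j → (1+X^ k ⋆ f) j ≡ f j + (if k ℕ.≤ᵇ j then f (j ∸ k) else 0ℤ)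
1+X^-⋆ k f j = trans (⋆-+ₚ (1ℤ ∷ []) (X^ k) f j) (cong₂ _+_ (X^-⋆ 0 f j) (X^-⋆ k f j))

δ : Seq
δ zero    = 1ℤ
δ (suc _) = 0ℤ

subsetSums : List ℕ → Seq
subsetSums []      = δ
subsetSums (k ∷ μ) = 1+X^ k ⋆ subsetSums μ

subsetSums-ones : ∀ m → subsetSums (replicate m 1) ≗ binom m
subsetSums-ones zero    zero    = refl
subsetSums-ones zero    (suc j) = refl
subsetSums-ones (suc m) j       = trans (⋆-cong (1ℤ ∷ 1ℤ ∷ []) (subsetSums-ones m) j) (sym (binom-suc m j))

subsetSums-vanishes : ∀ μ {j} → sum μ ℕ.< j → subsetSums μ j ≡ 0ℤ
subsetSums-vanishes []      {suc j} _  = refl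
subsetSums-vanishes (k ∷ μ) {j}     lt =
  trans (1+X^-⋆ k (subsetSums μ) j)
        (cong₂ _+_ (subsetSums-vanishes μ (ℕ.≤-trans (s≤s (ℕ.m≤n+m (sum μ) k)) lt)) shifted)
  where
  shifted : (if k ℕ.≤ᵇ j then subsetSums μ (j ∸ k) else 0ℤ) ≡ 0ℤ
  shifted with k ℕ.≤ᵇ j | ℕ.≤ᵇ-reflects-≤ k j
  ... | true  | ofʸ k≤j = subsetSums-vanishes μ
                            (ℕ.+-cancelˡ-< k _ _ (subst (k ℕ.+ sum μ ℕ.<_) (sym (ℕ.m+[n∸m]≡n k≤j)) lt))
  ... | false | _       = refl

subsetSums-zero : ∀ {μ} → All (0 ℕ.<_) μ → subsetSums μ 0 ≡ 1ℤ
subsetSums-zero []              = refl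
subsetSums-zero (s≤s z≤n ∷ pos) = cong (λ x → + 1 * x + 0ℤ) (subsetSums-zero pos)

1-X⋆-vanishes : ∀ {n} {f : Seq} → (∀ i → n ℕ.< i → f i ≡ 0ℤ) →
                ∀ j → suc n ℕ.< j → (1-X ⋆ f) j ≡ 0ℤ
1-X⋆-vanishes f≡0 (suc j) (s≤s lt) =
  cong₂ _+_ (cong (1ℤ *_) (f≡0 (suc j) (ℕ.m<n⇒m<1+n lt)))
            (cong₂ _+_ (cong (-1ℤ *_) (f≡0 j lt)) (shift-zero j))

-- Murnaghan–Nakayama on the beads (a, b), kept in this order and allowed to collide: a part
-- moves one bead down, and the walks ending at (1, 0) count +1, those ending at (0, 1) count −1.
twoBead : List ℕ → ℕ → ℕ → ℤ
twoBead []      (suc zero) zero       = 1ℤ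
twoBead []      zero       (suc zero) = -1ℤ
twoBead []      _          _          = 0ℤ
twoBead (k ∷ μ) a          b          =
  (if k ℕ.≤ᵇ a then twoBead μ (a ∸ k) b else 0ℤ) + (if k ℕ.≤ᵇ b then twoBead μ a (b ∸ k) else 0ℤ)

if-neg : ∀ c x → (if c then - x else 0ℤ) ≡ - (if c then x else 0ℤ)
if-neg true  x = refl
if-neg false x = refl

twoBead-antisym : ∀ μ a b → twoBead μ a b ≡ - twoBead μ b a
twoBead-antisym []      zero          zero          = refl
twoBead-antisym []      zero          (suc zero)    = refl
twoBead-antisym []      zero          (suc (suc b)) = refl
twoBead-antisym []      (suc zero)    zero          = refl
twoBead-antisym []      (suc zero)    (suc zero)    = refl
twoBead-antisym []      (suc zero)    (suc (suc b)) = refl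
twoBead-antisym []      (suc (suc a)) zero          = refl
twoBead-antisym []      (suc (suc a)) (suc zero)    = refl
twoBead-antisym []      (suc (suc a)) (suc (suc b)) = refl
twoBead-antisym (k ∷ μ) a             b             =
  trans (cong₂ _+_ (moved a (twoBead-antisym μ (a ∸ k) b)) (moved b (twoBead-antisym μ a (b ∸ k))))
        (swap-neg (if k ℕ.≤ᵇ a then twoBead μ b (a ∸ k) else 0ℤ)
                  (if k ℕ.≤ᵇ b then twoBead μ (b ∸ k) a else 0ℤ))
  where
  moved : ∀ x {u v} → u ≡ - v → (if k ℕ.≤ᵇ x then u else 0ℤ) ≡ - (if k ℕ.≤ᵇ x then v else 0ℤ)
  moved x {v = v} u≡-v = trans (cong (λ z → if k ℕ.≤ᵇ x then z else 0ℤ) u≡-v) (if-neg (k ℕ.≤ᵇ x) v)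
  swap-neg : ∀ x y → - x + - y ≡ - (y + x)
  swap-neg = solve-∀

i≡-i⇒i≡0 : ∀ {i} → i ≡ - i → i ≡ 0ℤ
i≡-i⇒i≡0 {+ zero}   _ = refl
i≡-i⇒i≡0 {+ suc n}  ()
i≡-i⇒i≡0 { -[1+ n ]} ()

twoBead-diagonal : ∀ μ a → twoBead μ a a ≡ 0ℤ
twoBead-diagonal μ a = i≡-i⇒i≡0 (twoBead-antisym μ a a)

sum-after-moveˡ : ∀ {a b k s} → k ℕ.≤ a → a ℕ.+ b ≡ suc (k ℕ.+ s) → (a ∸ k) ℕ.+ b ≡ suc s
sum-after-moveˡ {a} {b} {k} {s} k≤a a+b≡ = begin
  (a ∸ k) ℕ.+ b        ≡⟨ ℕ.+-∸-comm b k≤a ⟨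
  (a ℕ.+ b) ∸ k        ≡⟨ cong (_∸ k) (trans a+b≡ (sym (ℕ.+-suc k s))) ⟩
  (k ℕ.+ suc s) ∸ k    ≡⟨ ℕ.m+n∸m≡n k (suc s) ⟩
  suc s                ∎
  where open ≡-Reasoning

sum-after-moveʳ : ∀ {a b k s} → k ℕ.≤ b → a ℕ.+ b ≡ suc (k ℕ.+ s) → a ℕ.+ (b ∸ k) ≡ suc s
sum-after-moveʳ {a} {b} {k} k≤b a+b≡ =
  trans (ℕ.+-comm a (b ∸ k)) (sum-after-moveˡ k≤b (trans (ℕ.+-comm b a) a+b≡))

twoBead-subsetSums : ∀ μ a b → a ℕ.+ b ≡ suc (sum μ) → twoBead μ a b ≡ (1-X ⋆ subsetSums μ) b
twoBead-subsetSums []      zero          (suc zero)    _ = refl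
twoBead-subsetSums []      (suc zero)    zero          _ = refl
twoBead-subsetSums []      zero          zero          ()
twoBead-subsetSums []      zero          (suc (suc b)) ()
twoBead-subsetSums []      (suc zero)    (suc b)       ()
twoBead-subsetSums []      (suc (suc a)) b             ()
twoBead-subsetSums (k ∷ μ) a             b             a+b≡ = begin
  twoBead (k ∷ μ) a b                          ≡⟨ cong₂ _+_ moveFirst moveSecond ⟩
  D b + (if k ℕ.≤ᵇ b then D (b ∸ k) else 0ℤ)   ≡⟨ 1+X^-⋆ k D b ⟨
  (1+X^ k ⋆ D) b
    ≡⟨ ⋆-commute (⋆-linearShiftInvariant 1-X) (1+X^ k) (subsetSums μ) b ⟨
  (1-X ⋆ subsetSums (k ∷ μ)) b                 ∎
  where
  open ≡-Reasoning
  D = 1-X ⋆ subsetSums μ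
  moveFirst : (if k ℕ.≤ᵇ a then twoBead μ (a ∸ k) b else 0ℤ) ≡ D b
  moveFirst with k ℕ.≤ᵇ a | ℕ.≤ᵇ-reflects-≤ k a
  ... | true  | ofʸ k≤a = twoBead-subsetSums μ (a ∸ k) b (sum-after-moveˡ k≤a a+b≡)
  ... | false | ofⁿ k≰a = sym (1-X⋆-vanishes (λ i → subsetSums-vanishes μ) b 1+s<b)
    where
    1+s<b : suc (sum μ) ℕ.< b
    1+s<b = ℕ.+-cancelˡ-< a _ _ (subst (a ℕ.+ suc (sum μ) ℕ.<_) (sym (trans a+b≡ (sym (ℕ.+-suc k (sum μ)))))
                                        (ℕ.+-monoˡ-< (suc (sum μ)) (ℕ.≰⇒> k≰a)))
  moveSecond : (if k ℕ.≤ᵇ b then twoBead μ a (b ∸ k) else 0ℤ) ≡ (if k ℕ.≤ᵇ b then D (b ∸ k) else 0ℤ)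
  moveSecond with k ℕ.≤ᵇ b | ℕ.≤ᵇ-reflects-≤ k b
  ... | true  | ofʸ k≤b = twoBead-subsetSums μ a (b ∸ k) (sum-after-moveʳ k≤b a+b≡)
  ... | false | _       = refl

1-X⋆subsetSums-antisym : ∀ μ j → j ℕ.≤ suc (sum μ) →
  (1-X ⋆ subsetSums μ) (suc (sum μ) ∸ j) ≡ - (1-X ⋆ subsetSums μ) j
1-X⋆subsetSums-antisym μ j j≤N = begin
  (1-X ⋆ subsetSums μ) (N ∸ j)   ≡⟨ twoBead-subsetSums μ j (N ∸ j) (ℕ.m+[n∸m]≡n j≤N) ⟨
  twoBead μ j (N ∸ j)            ≡⟨ twoBead-antisym μ j (N ∸ j) ⟩
  - twoBead μ (N ∸ j) j          ≡⟨ cong -_ (twoBead-subsetSums μ (N ∸ j) j (ℕ.m∸n+n≡m j≤N)) ⟩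
  - (1-X ⋆ subsetSums μ) j       ∎
  where
  open ≡-Reasoning
  N = suc (sum μ)

-- Two-row characters

≡ᵇ-true : ∀ {m n} → m ≡ n → (m ℕ.≡ᵇ n) ≡ true
≡ᵇ-true = dec-true (_ ℕ.≟ _)

≡ᵇ-false : ∀ {m n} → m ≢ n → (m ℕ.≡ᵇ n) ≡ false
≡ᵇ-false = dec-false (_ ℕ.≟ _)

<ᵇ-true : ∀ {m n} → m ℕ.< n → (m ℕ.<ᵇ n) ≡ true
<ᵇ-true = dec-true (_ ℕ.<? _)

<ᵇ-false : ∀ {m n} → ¬ m ℕ.< n → (m ℕ.<ᵇ n) ≡ false
<ᵇ-false = dec-false (_ ℕ.<? _)

k<a⇒a∸[1+k]<a : ∀ {k a} → k ℕ.< a → a ∸ suc k ℕ.< a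
k<a⇒a∸[1+k]<a {k} (s≤s {n = a} k≤a) = s≤s (ℕ.m∸n≤m a k)

k<a⇒a≢a∸[1+k] : ∀ {k a} → k ℕ.< a → a ≢ a ∸ suc k
k<a⇒a≢a∸[1+k] k<a a≡r = ℕ.<-irrefl (sym a≡r) (k<a⇒a∸[1+k]<a k<a)

-- The summand of Defs.mn for the bead b of β, which is local to mn there.
hookRemoval : ℕ → List ℕ → List ℕ → ℕ → ℤ
hookRemoval k β μ b =
  if (k ℕ.≤ᵇ b) ∧ not (memᵇ (b ∸ k) β)
  then sgn (length (filterᵇ (λ c → ((b ∸ k) ℕ.<ᵇ c) ∧ (c ℕ.<ᵇ b)) β))
         * mn (map (λ c → if c ℕ.≡ᵇ b then b ∸ k else c) β) μ
  else 0ℤ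

-- The sign of the permutation sorting (a, b) into decreasing order.
order : ℕ → ℕ → ℤ
order a b = if b ℕ.<ᵇ a then 1ℤ else -1ℤ

b<a⇒order≡1 : ∀ {a b} → b ℕ.< a → order a b ≡ 1ℤ
b<a⇒order≡1 b<a = cong (λ c → if c then 1ℤ else -1ℤ) (<ᵇ-true b<a)

order-moveFirst : ∀ {r a b} → r ℕ.< a → r ≢ b →
  sgn (length (filterᵇ (λ c → (r ℕ.<ᵇ c) ∧ (c ℕ.<ᵇ a)) (b ∷ []))) * order r b ≡ order a b
order-moveFirst {r} {a} {b} r<a r≢b with ℕ.<-cmp b r
... | tri< b<r _ _ rewrite <ᵇ-false (ℕ.<⇒≯ b<r) | <ᵇ-true b<r | <ᵇ-true (ℕ.<-trans b<r r<a) = refl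
... | tri≈ _ b≡r _ = ⊥-elim (r≢b (sym b≡r))
... | tri> _ _ r<b rewrite <ᵇ-true r<b | <ᵇ-false (ℕ.<⇒≯ r<b) with b ℕ.<ᵇ a
...   | true  = refl
...   | false = refl

order-moveSecond : ∀ {a r b} → r ℕ.< b → a ≢ r → a ≢ b →
  sgn (length (filterᵇ (λ c → (r ℕ.<ᵇ c) ∧ (c ℕ.<ᵇ b)) (a ∷ b ∷ []))) * order a r ≡ order a b
order-moveSecond {a} {r} {b} r<b a≢r a≢b with ℕ.<-cmp a r | ℕ.<-cmp a b
... | tri≈ _ a≡r _ | _            = ⊥-elim (a≢r a≡r)
... | _            | tri≈ _ a≡b _ = ⊥-elim (a≢b a≡b)
... | tri< a<r _ _ | _
  rewrite <ᵇ-false (ℕ.<⇒≯ a<r) | <ᵇ-false (ℕ.<⇒≯ (ℕ.<-trans a<r r<b))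
        | <ᵇ-true r<b | <ᵇ-false (ℕ.n≮n b) = refl
... | tri> _ _ r<a | tri< a<b _ _
  rewrite <ᵇ-true r<a | <ᵇ-true a<b | <ᵇ-false (ℕ.<⇒≯ a<b) | <ᵇ-true r<b | <ᵇ-false (ℕ.n≮n b) = refl
... | tri> _ _ r<a | tri> _ _ b<a
  rewrite <ᵇ-true r<a | <ᵇ-false (ℕ.<⇒≯ b<a) | <ᵇ-true b<a | <ᵇ-true r<b | <ᵇ-false (ℕ.n≮n b) = refl

TwoBeadFormula : List ℕ → Set
TwoBeadFormula μ =
  ∀ a b → a ≢ b → a ℕ.+ b ≡ suc (sum μ) → mn (a ∷ b ∷ []) μ ≡ order a b * twoBead μ a b

hookRemoval-first : ∀ {k μ a b} → 0 ℕ.< k → a ≢ b → a ℕ.+ b ≡ suc (k ℕ.+ sum μ) →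
  TwoBeadFormula μ →
  hookRemoval k (a ∷ b ∷ []) μ a ≡ order a b * (if k ℕ.≤ᵇ a then twoBead μ (a ∸ k) b else 0ℤ)
hookRemoval-first {suc k} {μ} {a} {b} _ a≢b a+b≡ ih with k ℕ.<ᵇ a | ℕ.<ᵇ-reflects-< k a
... | false | _ = sym (*-zeroʳ (order a b))
... | true  | ofʸ k<a with b ℕ.≟ a ∸ suc k
...   | yes b≡r rewrite ≡ᵇ-false (k<a⇒a≢a∸[1+k] k<a) | ≡ᵇ-true b≡r =
  sym (trans (cong (λ r → order a b * twoBead μ r b) (sym b≡r))
             (trans (cong (order a b *_) (twoBead-diagonal μ b)) (*-zeroʳ (order a b))))
...   | no b≢r
  rewrite ≡ᵇ-false (k<a⇒a≢a∸[1+k] k<a) | ≡ᵇ-false b≢r | <ᵇ-true (k<a⇒a∸[1+k]<a k<a)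
        | <ᵇ-false (ℕ.n≮n a) | ≡ᵇ-true {a} refl | ≡ᵇ-false (a≢b ∘ sym) =
  trans (cong (σ *_) (ih r b (b≢r ∘ sym) (sum-after-moveˡ k<a a+b≡)))
        (trans (sym (*-assoc σ (order r b) (twoBead μ r b)))
               (cong (_* twoBead μ r b) (order-moveFirst (k<a⇒a∸[1+k]<a k<a) (b≢r ∘ sym))))
  where
  r = a ∸ suc k
  σ = sgn (length (filterᵇ (λ c → (r ℕ.<ᵇ c) ∧ (c ℕ.<ᵇ a)) (b ∷ [])))

hookRemoval-second : ∀ {k μ a b} → 0 ℕ.< k → a ≢ b → a ℕ.+ b ≡ suc (k ℕ.+ sum μ) →
  TwoBeadFormula μ →
  hookRemoval k (a ∷ b ∷ []) μ b ≡ order a b * (if k ℕ.≤ᵇ b then twoBead μ a (b ∸ k) else 0ℤ)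
hookRemoval-second {suc k} {μ} {a} {b} _ a≢b a+b≡ ih with k ℕ.<ᵇ b | ℕ.<ᵇ-reflects-< k b
... | false | _ = sym (*-zeroʳ (order a b))
... | true  | ofʸ k<b with a ℕ.≟ b ∸ suc k
...   | yes a≡r rewrite ≡ᵇ-true a≡r =
  sym (trans (cong (λ r → order a b * twoBead μ a r) (sym a≡r))
             (trans (cong (order a b *_) (twoBead-diagonal μ a)) (*-zeroʳ (order a b))))
...   | no a≢r
  rewrite ≡ᵇ-false a≢r | ≡ᵇ-false (k<a⇒a≢a∸[1+k] k<b) | ≡ᵇ-false a≢b | ≡ᵇ-true {b} refl =
  trans (cong (σ *_) (ih a r a≢r (sum-after-moveʳ k<b a+b≡)))
        (trans (sym (*-assoc σ (order a r) (twoBead μ a r)))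
               (cong (_* twoBead μ a r) (order-moveSecond (k<a⇒a∸[1+k]<a k<b) a≢r a≢b)))
  where
  r = b ∸ suc k
  σ = sgn (length (filterᵇ (λ c → (r ℕ.<ᵇ c) ∧ (c ℕ.<ᵇ b)) (a ∷ b ∷ [])))

mn-twoBeads : ∀ {μ} → All (0 ℕ.<_) μ → TwoBeadFormula μ
mn-twoBeads []                 zero          (suc zero)    _   _    = refl
mn-twoBeads []                 (suc zero)    zero          _   _    = refl
mn-twoBeads []                 zero          zero          _   ()
mn-twoBeads []                 zero          (suc (suc b)) _   ()
mn-twoBeads []                 (suc zero)    (suc b)       _   ()
mn-twoBeads []                 (suc (suc a)) b             _   ()
mn-twoBeads {k ∷ μ} (k>0 ∷ pos) a            b             a≢b a+b≡ =
  trans (cong₂ _+_ (hookRemoval-first {μ = μ} k>0 a≢b a+b≡ ih)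
                   (cong (_+ 0ℤ) (hookRemoval-second {μ = μ} k>0 a≢b a+b≡ ih)))
        (factor (order a b) _ _)
  where
  ih = mn-twoBeads pos
  factor : ∀ o x y → o * x + (o * y + 0ℤ) ≡ o * (x + y)
  factor = solve-∀

mn-oneBead : ∀ {μ} → All (0 ℕ.<_) μ → ∀ a → a ≡ sum μ → mn (a ∷ []) μ ≡ 1ℤ
mn-oneBead []                          a _  = refl
mn-oneBead {suc k ∷ μ} (s≤s z≤n ∷ pos) a a≡ with subst (k ℕ.<_) (sym a≡) (s≤s (ℕ.m≤m+n k (sum μ)))
... | k<a
  rewrite <ᵇ-true k<a | ≡ᵇ-false (k<a⇒a≢a∸[1+k] k<a) | <ᵇ-true (k<a⇒a∸[1+k]<a k<a)
        | <ᵇ-false (ℕ.n≮n a) | ≡ᵇ-true {a} refl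
        | mn-oneBead pos (a ∸ suc k) (ℕ.+-cancelˡ-≡ (suc k) _ _ (trans (ℕ.m+[n∸m]≡n k<a) a≡)) = refl

betaSet-twoRow : ∀ n j → betaSet (twoRow n (suc j)) ≡ suc (n ∸ suc j) ∷ suc j ∷ []
betaSet-twoRow n j = cong₂ (λ a b → a ∷ b ∷ []) (ℕ.+-comm (n ∸ suc j) 1) (ℕ.+-identityʳ (suc j))

χ-twoRow : ∀ {μ} → All (0 ℕ.<_) μ → ∀ j → j ℕ.+ j ℕ.≤ sum μ →
           χ (twoRow (sum μ) j) μ ≡ (1-X ⋆ subsetSums μ) j
χ-twoRow {μ} pos zero    _ =
  trans (mn-oneBead pos (sum μ ℕ.+ 0) (ℕ.+-identityʳ (sum μ)))
        (sym (cong (λ x → 1ℤ * x + 0ℤ) (subsetSums-zero pos)))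
χ-twoRow {μ} pos (suc j) 2j≤n = begin
  χ (twoRow n (suc j)) μ                  ≡⟨ cong (λ β → mn β μ) (betaSet-twoRow n j) ⟩
  mn (a ∷ suc j ∷ []) μ                   ≡⟨ mn-twoBeads pos a (suc j) (ℕ.<⇒≢ j<a ∘ sym) a+j≡ ⟩
  order a (suc j) * twoBead μ a (suc j)   ≡⟨ cong (_* twoBead μ a (suc j)) (b<a⇒order≡1 j<a) ⟩
  1ℤ * twoBead μ a (suc j)                ≡⟨ *-identityˡ _ ⟩
  twoBead μ a (suc j)                     ≡⟨ twoBead-subsetSums μ a (suc j) a+j≡ ⟩
  (1-X ⋆ subsetSums μ) (suc j)            ∎
  where
  open ≡-Reasoning
  n = sum μ
  a = suc (n ∸ suc j)
  j<a : suc j ℕ.< a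
  j<a = s≤s (ℕ.m+n≤o⇒m≤o∸n (suc j) 2j≤n)
  a+j≡ : a ℕ.+ suc j ≡ suc n
  a+j≡ = cong suc (ℕ.m∸n+n≡m (ℕ.m+n≤o⇒m≤o (suc j) 2j≤n))

halves : ∀ n → n ≡ n / 2 ℕ.+ n / 2 ⊎ n ≡ n / 2 ℕ.+ suc (n / 2)
halves zero          = inj₁ refl
halves (suc zero)    = inj₂ refl
halves (suc (suc n)) rewrite m/n≡1+[m∸n]/n {suc (suc n)} {2} (s≤s (s≤s z≤n)) with halves n
... | inj₁ n≡h+h   = inj₁ (cong suc (trans (cong suc n≡h+h) (sym (ℕ.+-suc (n / 2) (n / 2)))))
... | inj₂ n≡h+1+h = inj₂ (cong suc (trans (cong suc n≡h+1+h) (sym (ℕ.+-suc (n / 2) (suc (n / 2))))))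

n/2+n/2≤n : ∀ n → n / 2 ℕ.+ n / 2 ℕ.≤ n
n/2+n/2≤n n with halves n
... | inj₁ n≡h+h   = ℕ.≤-reflexive (sym n≡h+h)
... | inj₂ n≡h+1+h = subst (n / 2 ℕ.+ n / 2 ℕ.≤_) (sym n≡h+1+h) (ℕ.+-monoʳ-≤ (n / 2) (ℕ.n≤1+n (n / 2)))

sumTo-upperHalf : ∀ h a {N} (g : Seq) → suc (h ℕ.+ a) ≡ N → (∀ i → i ℕ.≤ h → g (N ∸ i) ≡ g i) →
                  sumTo h (λ i → g (suc (i ℕ.+ a))) ≡ sumTo h g
sumTo-upperHalf h a g refl g-sym = trans (sumTo-reverse h _) (sumTo-cong h reflect)
  where
  reflect : ∀ i → i ℕ.≤ h → g (suc ((h ∸ i) ℕ.+ a)) ≡ g i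
  reflect i i≤h = trans (cong g (trans (cong suc (sym (ℕ.+-∸-comm a i≤h)))
                                       (sym (ℕ.+-∸-assoc 1 (ℕ.≤-trans i≤h (ℕ.m≤m+n h a))))))
                        (g-sym i i≤h)

sumTo-squares-antisymmetric : ∀ n (f : Seq) → (∀ j → j ℕ.≤ suc n → f (suc n ∸ j) ≡ - f j) →
  sumTo (suc n) (λ j → f j * f j) ≡ sumTo (n / 2) (λ j → f j * f j) + sumTo (n / 2) (λ j → f j * f j)
sumTo-squares-antisymmetric n f f-anti = fold (halves n)
  where
  open ≡-Reasoning
  h = n / 2
  g : Seq
  g j = f j * f j
  h≤n : h ℕ.≤ n
  h≤n = ℕ.≤-trans (ℕ.m≤m+n h h) (n/2+n/2≤n n)
  g-sym : ∀ i → i ℕ.≤ h → g (suc n ∸ i) ≡ g i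
  g-sym i i≤h = trans (cong₂ _*_ (f-anti i i≤1+n) (f-anti i i≤1+n)) (neg-square (f i))
    where
    i≤1+n = ℕ.m≤n⇒m≤1+n (ℕ.≤-trans i≤h h≤n)
    neg-square : ∀ x → - x * - x ≡ x * x
    neg-square = solve-∀
  fold : n ≡ h ℕ.+ h ⊎ n ≡ h ℕ.+ suc h → sumTo (suc n) g ≡ sumTo h g + sumTo h g
  fold (inj₁ n≡h+h) = begin
    sumTo (suc n) g                                ≡⟨ cong (λ m → sumTo (suc m) g) n≡h+h ⟩
    sumTo (suc (h ℕ.+ h)) g                        ≡⟨ sumTo-split h h g ⟩
    sumTo h g + sumTo h (λ i → g (suc (i ℕ.+ h)))
      ≡⟨ cong (_+_ (sumTo h g)) (sumTo-upperHalf h h g (cong suc (sym n≡h+h)) g-sym) ⟩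
    sumTo h g + sumTo h g                          ∎
  fold (inj₂ n≡h+1+h) = begin
    sumTo (suc n) g                                ≡⟨ cong (λ m → sumTo (suc m) g) n≡h+1+h ⟩
    sumTo (suc (h ℕ.+ suc h)) g                    ≡⟨ sumTo-split (suc h) h g ⟩
    sumTo (suc h) g + sumTo h (λ i → g (suc (i ℕ.+ suc h)))
      ≡⟨ cong₂ _+_ dropMiddle (sumTo-upperHalf h (suc h) g (cong suc (sym n≡h+1+h)) g-sym) ⟩
    sumTo h g + sumTo h g                          ∎
    where
    middle≡ : suc h ≡ suc n ∸ suc h
    middle≡ = sym (trans (cong (_∸ h) n≡h+1+h) (ℕ.m+n∸m≡n h (suc h)))
    f-middle : f (suc h) ≡ 0ℤ
    f-middle = i≡-i⇒i≡0 (trans (cong f middle≡) (f-anti (suc h) (s≤s h≤n)))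
    dropMiddle : sumTo h g + g (suc h) ≡ sumTo h g
    dropMiddle = trans (cong (λ x → sumTo h g + x * x) f-middle) (+-identityʳ (sumTo h g))

χ-twoRow-sumSquares : ∀ {μ n} → All (0 ℕ.<_) μ → sum μ ≡ n →
  let u = 1-X ⋆ subsetSums μ
      S = sumTo (n / 2) (λ j → χ (twoRow n j) μ ^ 2)
  in S + S ≡ - cauchy u u (suc n)
χ-twoRow-sumSquares {μ} pos refl = begin
  S + S                                                  ≡⟨ cong₂ _+_ S≡ S≡ ⟩
  sumTo h (λ j → u j * u j) + sumTo h (λ j → u j * u j)
    ≡⟨ sumTo-squares-antisymmetric n u (1-X⋆subsetSums-antisym μ) ⟨
  sumTo (suc n) (λ j → u j * u j)                        ≡⟨ sumTo-cong (suc n) pair ⟩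
  sumTo (suc n) (λ j → - (u j * u (suc n ∸ j)))          ≡⟨ sumTo-neg (suc n) _ ⟩
  - cauchy u u (suc n)                                   ∎
  where
  open ≡-Reasoning
  n = sum μ
  h = n / 2
  u = 1-X ⋆ subsetSums μ
  S = sumTo h (λ j → χ (twoRow n j) μ ^ 2)
  S≡ : S ≡ sumTo h (λ j → u j * u j)
  S≡ = sumTo-cong h λ j j≤h →
    trans (cong (χ (twoRow n j) μ *_) (*-identityʳ _))
          (cong (λ x → x * x) (χ-twoRow pos j (ℕ.≤-trans (ℕ.+-mono-≤ j≤h j≤h) (n/2+n/2≤n n))))
  pair : ∀ j → j ℕ.≤ suc n → u j * u j ≡ - (u j * u (suc n ∸ j))
  pair j j≤ = sym (trans (cong (λ y → - (u j * y)) (1-X⋆subsetSums-antisym μ j j≤)) (negate-twice (u j)))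
    where
    negate-twice : ∀ x → - (x * - x) ≡ x * x
    negate-twice = solve-∀

-- The cycle type 3 2 1^m

Q₃₂₁ : Poly
Q₃₂₁ = 1-X ·ₚ (1+X^ 3 ·ₚ 1+X^ 2)

sum-replicate-1 : ∀ m → sum (replicate m 1) ≡ m
sum-replicate-1 zero    = refl
sum-replicate-1 (suc m) = cong suc (sum-replicate-1 m)

type321-subsetSums : ∀ m → 1-X ⋆ subsetSums (3 ∷ 2 ∷ replicate m 1) ≗ Q₃₂₁ ⋆ binom m
type321-subsetSums m j = begin
  (1-X ⋆ (1+X^ 3 ⋆ (1+X^ 2 ⋆ subsetSums (replicate m 1)))) j
    ≡⟨ ⋆-cong 1-X (⋆-cong (1+X^ 3) (⋆-cong (1+X^ 2) (subsetSums-ones m))) j ⟩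
  (1-X ⋆ (1+X^ 3 ⋆ (1+X^ 2 ⋆ binom m))) j
    ≡⟨ ⋆-cong 1-X (λ i → sym (⋆-·ₚ (1+X^ 3) (1+X^ 2) (binom m) i)) j ⟩
  (1-X ⋆ ((1+X^ 3 ·ₚ 1+X^ 2) ⋆ binom m)) j
    ≡⟨ ⋆-·ₚ 1-X (1+X^ 3 ·ₚ 1+X^ 2) (binom m) j ⟨
  (Q₃₂₁ ⋆ binom m) j
    ∎
  where open ≡-Reasoning

cauchy-type321 : ∀ n → let u = 1-X ⋆ subsetSums (type321 n) in
                 cauchy u u ≗ (Q₃₂₁ ·ₚ Q₃₂₁) ⋆ binom (2 ℕ.* (n ∸ 5))
cauchy-type321 n N = begin
  cauchy u u N                                     ≡⟨ cauchy-cong (type321-subsetSums m) (type321-subsetSums m) N ⟩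
  cauchy (Q₃₂₁ ⋆ binom m) (Q₃₂₁ ⋆ binom m) N       ≡⟨ cauchy-⋆ Q₃₂₁ Q₃₂₁ (binom m) (binom m) N ⟩
  ((Q₃₂₁ ·ₚ Q₃₂₁) ⋆ cauchy (binom m) (binom m)) N  ≡⟨ ⋆-cong (Q₃₂₁ ·ₚ Q₃₂₁) vandermonde′ N ⟩
  ((Q₃₂₁ ·ₚ Q₃₂₁) ⋆ binom (2 ℕ.* m)) N             ∎
  where
  open ≡-Reasoning
  m = n ∸ 5
  u = 1-X ⋆ subsetSums (type321 n)
  vandermonde′ : cauchy (binom m) (binom m) ≗ binom (2 ℕ.* m)
  vandermonde′ i = trans (vandermonde m m i) (cong (λ x → binom (m ℕ.+ x) i) (sym (ℕ.+-identityʳ m)))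

prodTo : ℕ → (ℕ → ℤ) → ℤ
prodTo zero    u = 1ℤ
prodTo (suc d) u = prodTo d u * u d

prodTo-+ : ∀ a b (u : ℕ → ℤ) → prodTo (a ℕ.+ b) u ≡ prodTo a u * prodTo b (λ i → u (a ℕ.+ i))
prodTo-+ a zero    u = trans (cong (λ d → prodTo d u) (ℕ.+-identityʳ a)) (sym (*-identityʳ _))
prodTo-+ a (suc b) u rewrite ℕ.+-suc a b = trans (cong (_* u (a ℕ.+ b)) (prodTo-+ a b u)) (*-assoc (prodTo a u) _ _)

prodTo-nonZero : ∀ d (u : ℕ → ℤ) → (∀ i → NonZero (u i)) → NonZero (prodTo d u)
prodTo-nonZero zero    u u≢0 = _
prodTo-nonZero (suc d) u u≢0 = i*j≢0 (prodTo d u) (u d) {{prodTo-nonZero d u u≢0}} {{u≢0 d}}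

ratio-chain : ∀ (x u v : ℕ → ℤ) d → (∀ i → i ℕ.< d → x (suc i) * u i ≡ x i * v i) →
              x d * prodTo d u ≡ x 0 * prodTo d v
ratio-chain x u v zero    step = refl
ratio-chain x u v (suc d) step = begin
  x (suc d) * (prodTo d u * u d)   ≡⟨ swap (x (suc d)) (prodTo d u) (u d) ⟩
  x (suc d) * u d * prodTo d u     ≡⟨ cong (_* prodTo d u) (step d ℕ.≤-refl) ⟩
  x d * v d * prodTo d u           ≡⟨ swap (x d) (prodTo d u) (v d) ⟨
  x d * (prodTo d u * v d)         ≡⟨ *-assoc (x d) _ _ ⟨
  x d * prodTo d u * v d           ≡⟨ cong (_* v d) (ratio-chain x u v d (λ i i<d → step i (ℕ.m<n⇒m<1+n i<d))) ⟩
  x 0 * prodTo d v * v d           ≡⟨ *-assoc (x 0) _ _ ⟩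
  x 0 * (prodTo d v * v d)         ∎
  where
  open ≡-Reasoning
  swap : ∀ a b c → a * (b * c) ≡ a * c * b
  swap = solve-∀

∣i-6∣≤6 : ∀ {i} → i ℕ.≤ 12 → ∣ i - 6 ∣ ℕ.≤ 6
∣i-6∣≤6 {i} i≤12 with ℕ.∣m-n∣≡[m∸n]∨[n∸m] i 6
... | inj₁ e = subst (ℕ._≤ 6) (sym e) (ℕ.∸-monoˡ-≤ 6 i≤12)
... | inj₂ e = subst (ℕ._≤ 6) (sym e) (ℕ.m∸n≤m 6 i)

-- For M = m and a = m + i: C(2m, a + 1) · rise = C(2m, a) · fall and
-- C(2a + 2, a + 1) · rise = C(2a, a) · centralFactor.
rise fall centralFactor : ℤ → ℕ → ℤ
rise          M i = + suc i + M
fall          M i = M - + i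
centralFactor M i = + 2 * (+ 1 + + 2 * (+ i + M))

-- C(2m, m + e) (m + 1) ⋯ (m + 6) = C(2m, m) · offCentreNumerator m e, for e ≤ 6.
offCentreNumerator : ℤ → ℕ → ℤ
offCentreNumerator M e = prodTo e (fall M) * prodTo (6 ∸ e) (λ i → rise M (e ℕ.+ i))

-- Products and powers are written as the unfoldings of prodTo and _^_, so that the identity
-- applies to them definitionally.
central-row-identity : ∀ M c →
  let n  = + 5 + M
      G₀ = 1ℤ * (1ℤ * (+ 1 + M) * (+ 2 + M) * (+ 3 + M) * (+ 4 + M) * (+ 5 + M) * (+ 6 + M))
      G₁ = (1ℤ * (M - + 0)) * (1ℤ * (+ 2 + M) * (+ 3 + M) * (+ 4 + M) * (+ 5 + M) * (+ 6 + M))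
      G₂ = (1ℤ * (M - + 0) * (M - + 1)) * (1ℤ * (+ 3 + M) * (+ 4 + M) * (+ 5 + M) * (+ 6 + M))
      G₃ = (1ℤ * (M - + 0) * (M - + 1) * (M - + 2)) * (1ℤ * (+ 4 + M) * (+ 5 + M) * (+ 6 + M))
      G₄ = (1ℤ * (M - + 0) * (M - + 1) * (M - + 2) * (M - + 3)) * (1ℤ * (+ 5 + M) * (+ 6 + M))
      G₅ = (1ℤ * (M - + 0) * (M - + 1) * (M - + 2) * (M - + 3) * (M - + 4)) * (1ℤ * (+ 6 + M))
      G₆ = (1ℤ * (M - + 0) * (M - + 1) * (M - + 2) * (M - + 3) * (M - + 4) * (M - + 5)) * 1ℤ
      V  = 1ℤ * (+ 2 * (+ 1 + + 2 * (+ 0 + M))) * (+ 2 * (+ 1 + + 2 * (+ 1 + M)))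
              * (+ 2 * (+ 1 + + 2 * (+ 2 + M))) * (+ 2 * (+ 1 + + 2 * (+ 3 + M)))
              * (+ 2 * (+ 1 + + 2 * (+ 4 + M)))
  in (+ 4 * (+ 2 * n - + 1) * (+ 2 * n - + 3) * (+ 2 * n - + 5) * (+ 2 * n - + 7) * (n + + 1))
       * - (c * (- + 6 * G₀ + + 8 * G₁ - + 2 * G₂ - + 4 * G₃ + + 6 * G₄ - + 4 * G₅ + + 2 * G₆))
     ≡ + 2 * (+ 6 + M)
       * (n * (n * (n * (n * 1ℤ))) - + 20 * (n * (n * (n * 1ℤ))) + + 194 * (n * (n * 1ℤ)) - + 1045 * n + + 2520)
       * (c * V)
central-row-identity = solve-∀

central-row-algebra : ∀ M N S c₀ B → (∀ i → NonZero (rise M i)) → N ≡ + 5 + M →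
  prodTo 6 (rise M) * (S + S)
    ≡ - ((Q₃₂₁ ·ₚ Q₃₂₁) ⋆ (λ i → c₀ * offCentreNumerator M ∣ i - 6 ∣)) 12 →
  B * prodTo 5 (rise M) ≡ c₀ * prodTo 5 (centralFactor M) →
  S * (+ 4 * (+ 2 * N - + 1) * (+ 2 * N - + 3) * (+ 2 * N - + 5) * (+ 2 * N - + 7) * (N + + 1))
    ≡ (N ^ 4 - + 20 * N ^ 3 + + 194 * N ^ 2 - + 1045 * N + + 2520) * B
central-row-algebra M .(+ 5 + M) S c₀ B rise≢0 refl hS hB =
  *-cancelˡ-≡ (+ 2 * E) _ _ {{i*j≢0 (+ 2) E {{_}} {{prodTo-nonZero 6 (rise M) rise≢0}}}} (begin
    + 2 * E * (S * D)                                          ≡⟨ rearrange₁ E S D ⟩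
    D * (E * (S + S))                                          ≡⟨ cong (D *_) hS ⟩
    D * - ((Q₃₂₁ ·ₚ Q₃₂₁) ⋆ (λ i → c₀ * G ∣ i - 6 ∣)) 12
      ≡⟨ cong (λ y → D * - y) (fold c₀ (G 0) (G 1) (G 2) (G 3) (G 4) (G 5) (G 6)) ⟩
    D * - (c₀ * W)                                             ≡⟨ central-row-identity M c₀ ⟩
    + 2 * rise M 5 * P * (c₀ * prodTo 5 (centralFactor M))     ≡⟨ cong (+ 2 * rise M 5 * P *_) hB ⟨
    + 2 * rise M 5 * P * (B * prodTo 5 (rise M))               ≡⟨ rearrange₂ (rise M 5) P B (prodTo 5 (rise M)) ⟩
    + 2 * E * (P * B)                                          ∎)
  where
  open ≡-Reasoning
  E = prodTo 6 (rise M)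
  G = offCentreNumerator M
  N = + 5 + M
  D = + 4 * (+ 2 * N - + 1) * (+ 2 * N - + 3) * (+ 2 * N - + 5) * (+ 2 * N - + 7) * (N + + 1)
  P = N ^ 4 - + 20 * N ^ 3 + + 194 * N ^ 2 - + 1045 * N + + 2520
  W = - + 6 * G 0 + + 8 * G 1 - + 2 * G 2 - + 4 * G 3 + + 6 * G 4 - + 4 * G 5 + + 2 * G 6
  rearrange₁ : ∀ e s d → + 2 * e * (s * d) ≡ d * (e * (s + s))
  rearrange₁ = solve-∀
  rearrange₂ : ∀ a p b q → + 2 * a * p * (b * q) ≡ + 2 * (q * a) * (p * b)
  rearrange₂ = solve-∀
  fold : ∀ c g₀ g₁ g₂ g₃ g₄ g₅ g₆ →
    + 1 * (c * g₆) + (- + 2 * (c * g₅) + (+ 3 * (c * g₄) + (- + 2 * (c * g₃) + (- + 1 * (c * g₂)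
      + (+ 4 * (c * g₁) + (- + 6 * (c * g₀) + (+ 4 * (c * g₁) + (- + 1 * (c * g₂) + (- + 2 * (c * g₃)
      + (+ 3 * (c * g₄) + (- + 2 * (c * g₅) + (+ 1 * (c * g₆) + 0ℤ))))))))))))
    ≡ c * (- + 6 * g₀ + + 8 * g₁ - + 2 * g₂ - + 4 * g₃ + + 6 * g₄ - + 4 * g₅ + + 2 * g₆)
  fold = solve-∀

-- n = 12 + k is the degree and m = 7 + k the number of fixed points.
module CentralRow (k : ℕ) where

  m : ℕ
  m = 7 ℕ.+ k

  offCentre : ℕ → ℤ
  offCentre e = binom (2 ℕ.* m) (e ℕ.+ m)

  centralBinom : ℕ → ℤ
  centralBinom j = + ((2 ℕ.* (j ℕ.+ m)) C (j ℕ.+ m))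

  offCentre-ratio : ∀ i → i ℕ.≤ m → offCentre (suc i) * rise (+ m) i ≡ offCentre i * fall (+ m) i
  offCentre-ratio i i≤m = begin
    offCentre (suc i) * rise (+ m) i                 ≡⟨ pos-* ((2 ℕ.* m) C suc (i ℕ.+ m)) (suc (i ℕ.+ m)) ⟨
    + (((2 ℕ.* m) C suc (i ℕ.+ m)) ℕ.* suc (i ℕ.+ m))
                                                     ≡⟨ cong +_ (absorption (2 ℕ.* m) (i ℕ.+ m)) ⟩
    + (((2 ℕ.* m) C (i ℕ.+ m)) ℕ.* (2 ℕ.* m ∸ (i ℕ.+ m)))
                                                     ≡⟨ cong (λ x → + (((2 ℕ.* m) C (i ℕ.+ m)) ℕ.* x)) 2m∸[i+m]≡m∸i ⟩
    + (((2 ℕ.* m) C (i ℕ.+ m)) ℕ.* (m ∸ i))          ≡⟨ pos-* ((2 ℕ.* m) C (i ℕ.+ m)) (m ∸ i) ⟩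
    offCentre i * + (m ∸ i)                          ≡⟨ cong (offCentre i *_) +[m∸i]≡m-i ⟩
    offCentre i * fall (+ m) i                       ∎
    where
    open ≡-Reasoning
    2m∸[i+m]≡m∸i : 2 ℕ.* m ∸ (i ℕ.+ m) ≡ m ∸ i
    2m∸[i+m]≡m∸i = trans (cong₂ _∸_ (cong (m ℕ.+_) (ℕ.+-identityʳ m)) (ℕ.+-comm i m)) (ℕ.[m+n]∸[m+o]≡n∸o m m i)
    +[m∸i]≡m-i : + (m ∸ i) ≡ + m - + i
    +[m∸i]≡m-i = trans (sym (⊖-≥ i≤m)) (sym (m-n≡m⊖n m i))

  centralBinom-ratio : ∀ i → centralBinom (suc i) * rise (+ m) i ≡ centralBinom i * centralFactor (+ m) i
  centralBinom-ratio i = begin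
    centralBinom (suc i) * rise (+ m) i                ≡⟨ pos-* ((2 ℕ.* suc a) C suc a) (suc a) ⟨
    + (((2 ℕ.* suc a) C suc a) ℕ.* suc a)              ≡⟨ cong +_ (central-binomial-step a) ⟩
    + (((2 ℕ.* a) C a) ℕ.* (2 ℕ.* suc (2 ℕ.* a)))      ≡⟨ pos-* ((2 ℕ.* a) C a) _ ⟩
    centralBinom i * + (2 ℕ.* suc (2 ℕ.* a))           ≡⟨ cong (centralBinom i *_) centralFactor≡ ⟨
    centralBinom i * centralFactor (+ m) i             ∎
    where
    open ≡-Reasoning
    a = i ℕ.+ m
    centralFactor≡ : centralFactor (+ m) i ≡ + (2 ℕ.* suc (2 ℕ.* a))
    centralFactor≡ = trans (cong (λ x → + 2 * (+ 1 + x)) (sym (pos-* 2 a))) (sym (pos-* 2 (suc (2 ℕ.* a))))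

  offCentre-common : ∀ e → e ℕ.≤ 6 →
                     offCentre e * prodTo 6 (rise (+ m)) ≡ offCentre 0 * offCentreNumerator (+ m) e
  offCentre-common e e≤6 = begin
    offCentre e * prodTo 6 (rise (+ m))
      ≡⟨ cong (λ d → offCentre e * prodTo d (rise (+ m))) (ℕ.m+[n∸m]≡n e≤6) ⟨
    offCentre e * prodTo (e ℕ.+ (6 ∸ e)) (rise (+ m))
      ≡⟨ cong (offCentre e *_) (prodTo-+ e (6 ∸ e) (rise (+ m))) ⟩
    offCentre e * (prodTo e (rise (+ m)) * rest)
      ≡⟨ *-assoc (offCentre e) _ _ ⟨
    offCentre e * prodTo e (rise (+ m)) * rest
      ≡⟨ cong (_* rest) (ratio-chain offCentre (rise (+ m)) (fall (+ m)) e ratio) ⟩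
    offCentre 0 * prodTo e (fall (+ m)) * rest
      ≡⟨ *-assoc (offCentre 0) _ _ ⟩
    offCentre 0 * offCentreNumerator (+ m) e
      ∎
    where
    open ≡-Reasoning
    rest = prodTo (6 ∸ e) (λ i → rise (+ m) (e ℕ.+ i))
    ratio : ∀ i → i ℕ.< e → offCentre (suc i) * rise (+ m) i ≡ offCentre i * fall (+ m) i
    ratio i i<e = offCentre-ratio i (ℕ.≤-trans (ℕ.<⇒≤ i<e) (ℕ.≤-trans e≤6 (ℕ.m≤m+n 6 (suc k))))

  offCentre-mirror : ∀ i → binom (2 ℕ.* m) (suc i ℕ.+ k) ≡ offCentre ∣ i - 6 ∣
  offCentre-mirror i =
    cong +_ (trans (central-symmetry m (suc i ℕ.+ k)) (cong (λ d → (2 ℕ.* m) C (d ℕ.+ m)) distance))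
    where
    distance : ∣ suc i ℕ.+ k - m ∣ ≡ ∣ i - 6 ∣
    distance = trans (cong₂ ∣_-_∣ (ℕ.+-comm (suc i) k) (ℕ.+-comm 7 k)) (ℕ.∣m+n-m+o∣≡∣n-o∣ k (suc i) 7)

  mirror-common : ∀ i → i ℕ.≤ 12 →
    prodTo 6 (rise (+ m)) * binom (2 ℕ.* m) (suc i ℕ.+ k) ≡ offCentre 0 * offCentreNumerator (+ m) ∣ i - 6 ∣
  mirror-common i i≤12 =
    trans (cong (prodTo 6 (rise (+ m)) *_) (offCentre-mirror i))
          (trans (*-comm (prodTo 6 (rise (+ m))) (offCentre ∣ i - 6 ∣))
                 (offCentre-common ∣ i - 6 ∣ (∣i-6∣≤6 i≤12)))

  -- The implicit arguments are given explicitly: inferring them by unification would make Agda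
  -- normalise the character sum.  The last step is definitional, since the degree-12 polynomial
  -- evaluated at 13 + k only reads the binomials at indices 1 + k, …, 13 + k.
  sumSquares-321 : ∀ n → n ≡ 12 ℕ.+ k →
    let S = sumTo (n / 2) (λ j → χ (twoRow n j) (type321 n) ^ 2) in
    S + S ≡ - ((Q₃₂₁ ·ₚ Q₃₂₁) ⋆ (λ i → binom (2 ℕ.* m) (suc i ℕ.+ k))) 12
  sumSquares-321 .(12 ℕ.+ k) refl =
    trans (χ-twoRow-sumSquares {type321 (12 ℕ.+ k)} {12 ℕ.+ k}
                               (s≤s z≤n ∷ s≤s z≤n ∷ All.replicate⁺ m (s≤s z≤n))
                               (cong (5 ℕ.+_) (sum-replicate-1 m)))
          (cong -_ (cauchy-type321 (12 ℕ.+ k) (13 ℕ.+ k)))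

  sumSquares-common : ∀ n → n ≡ 12 ℕ.+ k →
    let S = sumTo (n / 2) (λ j → χ (twoRow n j) (type321 n) ^ 2) in
    prodTo 6 (rise (+ m)) * (S + S)
      ≡ - ((Q₃₂₁ ·ₚ Q₃₂₁) ⋆ (λ i → offCentre 0 * offCentreNumerator (+ m) ∣ i - 6 ∣)) 12
  sumSquares-common n n≡ = begin
    E * (S + S)                                                  ≡⟨ cong (E *_) (sumSquares-321 n n≡) ⟩
    E * - ((Q₃₂₁ ·ₚ Q₃₂₁) ⋆ (λ i → binom (2 ℕ.* m) (suc i ℕ.+ k))) 12
      ≡⟨ neg-distribʳ-* E (((Q₃₂₁ ·ₚ Q₃₂₁) ⋆ (λ i → binom (2 ℕ.* m) (suc i ℕ.+ k))) 12) ⟨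
    - (E * ((Q₃₂₁ ·ₚ Q₃₂₁) ⋆ (λ i → binom (2 ℕ.* m) (suc i ℕ.+ k))) 12)
      ≡⟨ cong -_ (⋆-commute (scale-linearShiftInvariant E) (Q₃₂₁ ·ₚ Q₃₂₁)
                            (λ i → binom (2 ℕ.* m) (suc i ℕ.+ k)) 12) ⟩
    - ((Q₃₂₁ ·ₚ Q₃₂₁) ⋆ (λ i → E * binom (2 ℕ.* m) (suc i ℕ.+ k))) 12
      ≡⟨ cong -_ (⋆-cong-≤ (Q₃₂₁ ·ₚ Q₃₂₁) 12 mirror-common) ⟩
    - ((Q₃₂₁ ·ₚ Q₃₂₁) ⋆ (λ i → offCentre 0 * offCentreNumerator (+ m) ∣ i - 6 ∣)) 12
      ∎
    where
    open ≡-Reasoning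
    E = prodTo 6 (rise (+ m))
    S = sumTo (n / 2) (λ j → χ (twoRow n j) (type321 n) ^ 2)

  closedForm : ∀ n → n ≡ 12 ℕ.+ k →
    sumTo (n / 2) (λ j → χ (twoRow n j) (type321 n) ^ 2)
      * (+ 4 * (+ 2 * + n - + 1) * (+ 2 * + n - + 3) * (+ 2 * + n - + 5) * (+ 2 * + n - + 7) * (+ n + + 1))
    ≡ ((+ n) ^ 4 - + 20 * (+ n) ^ 3 + + 194 * (+ n) ^ 2 - + 1045 * + n + + 2520) * + ((2 ℕ.* n) C n)
  closedForm n n≡ =
    central-row-algebra (+ m) (+ n) (sumTo (n / 2) (λ j → χ (twoRow n j) (type321 n) ^ 2)) (offCentre 0)
      (+ ((2 ℕ.* n) C n)) (λ _ → _) (cong +_ n≡) (sumSquares-common n n≡) central-common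
    where
    central-common : + ((2 ℕ.* n) C n) * prodTo 5 (rise (+ m)) ≡ offCentre 0 * prodTo 5 (centralFactor (+ m))
    central-common = subst (λ x → + ((2 ℕ.* x) C x) * prodTo 5 (rise (+ m))
                                    ≡ offCentre 0 * prodTo 5 (centralFactor (+ m)))
                           (sym n≡)
                           (ratio-chain centralBinom (rise (+ m)) (centralFactor (+ m)) 5 (λ i _ → centralBinom-ratio i))

-- The general argument evaluates a polynomial of degree 12 at n + 1, so it needs n ≥ 12;
-- the smaller cases are computed.
mainTheorem16 : (n : ℕ) → 5 ≤ n →
    sumTo (n / 2) (λ j → χ (twoRow n j) (type321 n) ^ 2)
      * (+ 4 * (+ 2 * + n - + 1) * (+ 2 * + n - + 3) * (+ 2 * + n - + 5) * (+ 2 * + n - + 7) * (+ n + + 1))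
    ≡ ((+ n) ^ 4 - + 20 * (+ n) ^ 3 + + 194 * (+ n) ^ 2 - + 1045 * + n + + 2520) * + ((2 ℕ.* n) C n)
mainTheorem16 1  (s≤s ())
mainTheorem16 2  (s≤s (s≤s ()))
mainTheorem16 3  (s≤s (s≤s (s≤s ())))
mainTheorem16 4  (s≤s (s≤s (s≤s (s≤s ()))))
mainTheorem16 5  _ = refl
mainTheorem16 6  _ = refl
mainTheorem16 7  _ = refl
mainTheorem16 8  _ = refl
mainTheorem16 9  _ = refl
mainTheorem16 10 _ = refl
mainTheorem16 11 _ = refl
mainTheorem16 n@(suc (suc (suc (suc (suc (suc (suc (suc (suc (suc (suc (suc k)))))))))))) _ = CentralRow.closedForm k n refl
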